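{- Let $G$ be a finite group. Every generating set of $G$ of cardinality $d(G)$ contains at least one involution if and only if $G$ is a generalized dihedral group.
   Context: $d(G)$ is the minimum cardinality of a generating set of $G$; an involution is an element of order $2$. $G$ is generalized dihedral if it contains an abelian subgroup $A$ of index $2$ and an element $\tau\in G\setminus A$ with $\tau^2=1$ and $\tau a\tau=a^{ -1}$ for all $a\in A$. -}

module Defs where

open import Level using (Level; _⊔_)
open import Algebra.Bundles using (Group)
open import Data.Nat using (ℕ; _≤_)
open import Data.Fin using (Fin)
open import Data.List using (List; length)
open import Data.List.Membership.Propositional using (_∈_)
open import Data.Product using (Σ; _×_; ∃)
open import Data.Sum using (_⊎_)
open import Relation.Nullary using (¬_)
open import Relation.Unary using (Pred)
open import Function.Bundles using (Inverse)
import Relation.Binary.PropositionalEquality as ≡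

module _ {c ℓ : Level} (G : Group c ℓ) where
  open Group G

  IsFiniteGroup : Set (c ⊔ ℓ)
  IsFiniteGroup = Σ ℕ λ n → Inverse setoid (≡.setoid (Fin n))

  data Gen (S : List Carrier) : Carrier → Set (c ⊔ ℓ) where
    gen  : ∀ {x} → x ∈ S → Gen S x
    unit : Gen S ε
    mul  : ∀ {x y} → Gen S x → Gen S y → Gen S (x ∙ y)
    inv  : ∀ {x} → Gen S x → Gen S (x ⁻¹)
    resp : ∀ {x y} → x ≈ y → Gen S x → Gen S y

  Generates : List Carrier → Set (c ⊔ ℓ)
  Generates S = ∀ x → Gen S x

  -- S is a generating set of cardinality d(G): it generates G and no generating
  -- list is shorter (such an S is automatically duplicate-free).
  MinGenSet : List Carrier → Set (c ⊔ ℓ)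
  MinGenSet S = Generates S × (∀ T → Generates T → length S ≤ length T)

  Involution : Carrier → Set ℓ
  Involution x = (¬ (x ≈ ε)) × (x ∙ x ≈ ε)

  IsSubgroup : Pred Carrier (c ⊔ ℓ) → Set (c ⊔ ℓ)
  IsSubgroup A =
    (∀ {x y} → x ≈ y → A x → A y) ×
    A ε ×
    (∀ {x y} → A x → A y → A (x ∙ y)) ×
    (∀ {x} → A x → A (x ⁻¹))

  IsAbelianSubset : Pred Carrier (c ⊔ ℓ) → Set (c ⊔ ℓ)
  IsAbelianSubset A = ∀ {x y} → A x → A y → x ∙ y ≈ y ∙ x

  HasIndex2 : Pred Carrier (c ⊔ ℓ) → Set (c ⊔ ℓ)
  HasIndex2 A = Σ Carrier λ a → Σ Carrier λ b →
    (¬ A (a ⁻¹ ∙ b)) × (∀ x → A (a ⁻¹ ∙ x) ⊎ A (b ⁻¹ ∙ x))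

  IsGeneralizedDihedral : Set (Level.suc (c ⊔ ℓ))
  IsGeneralizedDihedral =
    Σ (Pred Carrier (c ⊔ ℓ)) λ A →
      IsSubgroup A × IsAbelianSubset A × HasIndex2 A ×
      Σ Carrier λ τ →
        (¬ A τ) × (τ ∙ τ ≈ ε) × (∀ {a} → A a → (τ ∙ a) ∙ τ ≈ a ⁻¹)

-- (⇐, valid for every group) Let A be an abelian subgroup of index 2 and
-- τ ∉ A an involution inverting A.  Any s ∉ A lies in the coset τA, say
-- s = τa, and (τa)² = (τaτ)a = a⁻¹a = 1, so s is an involution.  A
-- generating set cannot lie inside the proper subgroup A, hence it contains
-- such an s.
--
-- (⇒) Finiteness makes equality and membership in generated subgroups
-- decidable (the subgroup is computed as a saturated finite subset), so a
-- minimal generating set exists.  Among minimal generating sets take one,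
-- S, with the fewest involutions; by hypothesis S contains an involution x.
-- Put K = S ∖ {x}.  If some g ∈ K ∪ KK has xg not an involution, then
-- replacing x by xg gives a minimal generating set with fewer involutions
-- (exchange lemma).  Otherwise x inverts all z and zw with z, w ∈ K, which
-- forces A = ⟨K⟩ to be abelian and inverted by x; as x ∉ A (minimality)
-- and G = A ∪ xA, the group G is generalized dihedral.
module Submission where

open import Level using (Level; _⊔_)
open import Algebra.Bundles using (Group)
open import Data.Nat using (ℕ; zero; suc; _≤_; _<_; s≤s)
open import Data.Nat.Properties
  using (≤-refl; <-irrefl; n<1+n; m<1+n⇒m<n∨m≡n; ≮⇒≥; <-≤-trans; suc-injective; module ≤-Reasoning)
open import Data.Fin using (Fin)
import Data.Fin.Properties as Fin
open import Data.Fin.Subset using (Subset; ⁅_⁆; _⊆_; _⊃_)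
  renaming (_∈_ to _∈ₛ_)
open import Data.Fin.Subset.Properties using (_∈?_; _⊂?_; x∈⁅x⁆; x∈⁅y⁆⇒x≡y)
open import Data.Fin.Subset.Induction using (Acc; acc; ⊃-wellFounded)
open import Data.Vec using (tabulate)
open import Data.Vec.Properties using (lookup∘tabulate; lookup⇒[]=; []=⇒lookup)
open import Data.List using (List; []; _∷_; length; map; _++_; allFin; filter)
open import Data.List.Properties
  using (length-map; length-tabulate; length-removeAt′; filter-reject)
open import Data.List.Relation.Unary.Any using (Any; here; there; any?; _─_)
import Data.List.Relation.Unary.Any as Any
open import Data.List.Relation.Unary.All using (All; all?)
import Data.List.Relation.Unary.All as All
open import Data.List.Relation.Unary.All.Properties using (¬All⇒Any¬)
open import Data.List.Membership.Propositional using (_∈_; find; lose)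
open import Data.List.Membership.Propositional.Properties
  using (∈-map⁺; ∈-map⁻; ∈-++⁺ˡ; ∈-++⁺ʳ; ∈-++⁻; ∈-allFin)
open import Data.Product using (Σ; _×_; _,_; proj₁; proj₂)
open import Data.Sum using (_⊎_; inj₁; inj₂)
open import Data.Bool using (true; false)
open import Relation.Nullary using (¬_; Dec; yes; no; does; contradiction)
open import Relation.Nullary.Decidable using (dec-true; map′; _⊎-dec_; _×-dec_; ¬?)
open import Relation.Unary using (Pred; Decidable)
open import Relation.Binary.PropositionalEquality as ≡ using (_≡_; refl; cong; subst)
open import Function.Bundles using (_⇔_; mk⇔; Inverse)
open import Defs

-- Identities in an arbitrary group.  x \\ y is the left quotient x⁻¹y, and
-- conj x a = xax, which for an involution x is conjugation by x.
module GroupFacts {c ℓ : Level} (G : Group c ℓ) where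
  open Group G
  open import Algebra.Properties.Group G
  open import Relation.Binary.Reasoning.Setoid setoid

  conj : Carrier → Carrier → Carrier
  conj x a = x ∙ a ∙ x

  conj-cong : ∀ x {a b} → a ≈ b → conj x a ≈ conj x b
  conj-cong x a≈b = ∙-congʳ (∙-congˡ a≈b)

  ε\\x≈x : ∀ x → ε \\ x ≈ x
  ε\\x≈x x = trans (∙-congʳ ε⁻¹≈ε) (identityˡ x)

  \\-trans : ∀ x y z → (x \\ y) ∙ (y \\ z) ≈ x \\ z
  \\-trans x y z = begin
    (x \\ y) ∙ (y \\ z)    ≈⟨ assoc _ _ _ ⟩
    x ⁻¹ ∙ (y ∙ (y \\ z))  ≈⟨ ∙-congˡ (\\-leftDividesˡ y z) ⟩
    x \\ z                 ∎

  inverted⇒square-ε : ∀ x a → conj x a ≈ a ⁻¹ → (x ∙ a) ∙ (x ∙ a) ≈ ε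
  inverted⇒square-ε x a xax≈a⁻¹ = begin
    (x ∙ a) ∙ (x ∙ a)  ≈⟨ assoc _ _ _ ⟨
    conj x a ∙ a       ≈⟨ ∙-congʳ xax≈a⁻¹ ⟩
    a ⁻¹ ∙ a           ≈⟨ inverseˡ a ⟩
    ε                  ∎

  square-ε⇒inverted : ∀ x a → (x ∙ a) ∙ (x ∙ a) ≈ ε → conj x a ≈ a ⁻¹
  square-ε⇒inverted x a sq = inverseˡ-unique (conj x a) a (trans (assoc _ _ _) sq)

  module _ {x : Carrier} (xx : x ∙ x ≈ ε) where

    involution-self-inverse : x ≈ x ⁻¹
    involution-self-inverse = inverseˡ-unique x x xx

    conj-∙ : ∀ a b → conj x (a ∙ b) ≈ conj x a ∙ conj x b
    conj-∙ a b = sym (begin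
      conj x a ∙ conj x b       ≈⟨ assoc _ _ _ ⟩
      x ∙ a ∙ (x ∙ (x ∙ b ∙ x)) ≈⟨ ∙-congˡ (assoc _ _ _) ⟨
      x ∙ a ∙ (x ∙ (x ∙ b) ∙ x) ≈⟨ ∙-congˡ (∙-congʳ (assoc _ _ _)) ⟨
      x ∙ a ∙ (x ∙ x ∙ b ∙ x)   ≈⟨ ∙-congˡ (∙-congʳ (∙-congʳ xx)) ⟩
      x ∙ a ∙ (ε ∙ b ∙ x)       ≈⟨ ∙-congˡ (∙-congʳ (identityˡ b)) ⟩
      x ∙ a ∙ (b ∙ x)           ≈⟨ assoc _ _ _ ⟨
      x ∙ a ∙ b ∙ x             ≈⟨ ∙-congʳ (assoc _ _ _) ⟩
      conj x (a ∙ b)            ∎)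

    conj-ε : conj x ε ≈ ε
    conj-ε = trans (∙-congʳ (identityʳ x)) xx

    conj-⁻¹ : ∀ a → conj x (a ⁻¹) ≈ (conj x a) ⁻¹
    conj-⁻¹ a = sym (begin
      (x ∙ a ∙ x) ⁻¹         ≈⟨ ⁻¹-anti-homo-∙ _ _ ⟩
      x ⁻¹ ∙ (x ∙ a) ⁻¹      ≈⟨ ∙-cong (sym involution-self-inverse) (⁻¹-anti-homo-∙ _ _) ⟩
      x ∙ (a ⁻¹ ∙ x ⁻¹)      ≈⟨ ∙-congˡ (∙-congˡ (sym involution-self-inverse)) ⟩
      x ∙ (a ⁻¹ ∙ x)         ≈⟨ assoc _ _ _ ⟨
      conj x (a ⁻¹)          ∎)

    inverted⇒commute : ∀ {a b} → conj x a ≈ a ⁻¹ → conj x b ≈ b ⁻¹ →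
                       conj x (a ∙ b) ≈ (a ∙ b) ⁻¹ → a ∙ b ≈ b ∙ a
    inverted⇒commute {a} {b} inv-a inv-b inv-ab = begin
      a ∙ b                   ≈⟨ ⁻¹-involutive _ ⟨
      (a ∙ b) ⁻¹ ⁻¹           ≈⟨ ⁻¹-cong inv-ab ⟨
      (conj x (a ∙ b)) ⁻¹     ≈⟨ ⁻¹-cong (conj-∙ a b) ⟩
      (conj x a ∙ conj x b) ⁻¹ ≈⟨ ⁻¹-cong (∙-cong inv-a inv-b) ⟩
      (a ⁻¹ ∙ b ⁻¹) ⁻¹        ≈⟨ ⁻¹-anti-homo-∙ _ _ ⟩
      b ⁻¹ ⁻¹ ∙ a ⁻¹ ⁻¹       ≈⟨ ∙-cong (⁻¹-involutive b) (⁻¹-involutive a) ⟩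
      b ∙ a                   ∎

    -- How left quotients by x interact with products and inverses; these
    -- show that A ∪ xA is closed when x normalises A.
    \\-∙ˡ : ∀ u v → x \\ (u ∙ v) ≈ conj x u ∙ (x \\ v)
    \\-∙ˡ u v = sym (begin
      conj x u ∙ (x \\ v)    ≈⟨ assoc _ _ _ ⟩
      x ∙ u ∙ (x ∙ (x \\ v)) ≈⟨ ∙-congˡ (\\-leftDividesˡ x v) ⟩
      x ∙ u ∙ v              ≈⟨ assoc _ _ _ ⟩
      x ∙ (u ∙ v)            ≈⟨ ∙-congʳ involution-self-inverse ⟩
      x \\ (u ∙ v)           ∎)

    \\-⁻¹ : ∀ u → x \\ u ⁻¹ ≈ conj x ((x \\ u) ⁻¹)
    \\-⁻¹ u = sym (begin
      x ∙ (x \\ u) ⁻¹ ∙ x    ≈⟨ ∙-congʳ (∙-congˡ (⁻¹-anti-homo-\\ x u)) ⟩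
      x ∙ (u \\ x) ∙ x       ≈⟨ assoc _ _ _ ⟩
      x ∙ (u ⁻¹ ∙ x ∙ x)     ≈⟨ ∙-congˡ (assoc _ _ _) ⟩
      x ∙ (u ⁻¹ ∙ (x ∙ x))   ≈⟨ ∙-congˡ (∙-congˡ xx) ⟩
      x ∙ (u ⁻¹ ∙ ε)         ≈⟨ ∙-cong involution-self-inverse (identityʳ _) ⟩
      x \\ u ⁻¹              ∎)

  -- A product of two elements of xA lies in A once xA·x is rewritten.
  \\-∙-\\ : ∀ x u v → u ∙ v ≈ conj x (x \\ u) ∙ (x \\ v)
  \\-∙-\\ x u v = sym (begin
    x ∙ (x \\ u) ∙ x ∙ (x \\ v)  ≈⟨ ∙-congʳ (∙-congʳ (\\-leftDividesˡ x u)) ⟩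
    u ∙ x ∙ (x \\ v)             ≈⟨ assoc _ _ _ ⟩
    u ∙ (x ∙ (x \\ v))           ≈⟨ ∙-congˡ (\\-leftDividesˡ x v) ⟩
    u ∙ v                        ∎)

module ListRemoval {a} {A : Set a} where

  ∈-─ : ∀ {x z : A} {S} (p : x ∈ S) → z ∈ S → z ≡ x ⊎ z ∈ (S ─ p)
  ∈-─ (here refl) (here z≡x) = inj₁ z≡x
  ∈-─ (here _)    (there q)  = inj₂ q
  ∈-─ (there p)   (here z≡y) = inj₂ (here z≡y)
  ∈-─ (there p)   (there q)  with ∈-─ p q
  ... | inj₁ z≡x = inj₁ z≡x
  ... | inj₂ r   = inj₂ (there r)

  length-─ : ∀ {x : A} {S} (p : x ∈ S) → length S ≡ suc (length (S ─ p))
  length-─ {S = S} p = length-removeAt′ S (Any.index p)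

  count-─ : ∀ {q} {P : Pred A q} (P? : Decidable P) {x S} (p : x ∈ S) → P x →
            length (filter P? S) ≡ suc (length (filter P? (S ─ p)))
  count-─ P? {x} (here refl) Px with P? x
  ... | yes _  = refl
  ... | no ¬Px = contradiction Px ¬Px
  count-─ P? {S = y ∷ S} (there p) Px with does (P? y)
  ... | true  = cong suc (count-─ P? p Px)
  ... | false = count-─ P? p Px

module Generation {c ℓ : Level} (G : Group c ℓ) where
  open Group G hiding (refl)
  open ListRemoval
  open import Algebra.Properties.Group G using (//-rightDividesʳ; \\-leftDividesʳ)

  -- Closure under ≈, identity, products and inverses, for a predicate of any
  -- level; at level c ⊔ ℓ this is exactly IsSubgroup.
  SubgroupClosed : ∀ {p} → Pred Carrier p → Set (c ⊔ ℓ ⊔ p)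
  SubgroupClosed A =
    (∀ {x y} → x ≈ y → A x → A y) ×
    A ε ×
    (∀ {x y} → A x → A y → A (x ∙ y)) ×
    (∀ {x} → A x → A (x ⁻¹))

  Gen-least : ∀ {p} {A : Pred Carrier p} {S} → SubgroupClosed A →
              (∀ {s} → s ∈ S → A s) → ∀ {x} → Gen G S x → A x
  Gen-least _                        S⊆A (gen s∈S)   = S⊆A s∈S
  Gen-least (_ , Aε , _)             S⊆A unit        = Aε
  Gen-least A@(_ , _ , A∙ , _)       S⊆A (mul g h)   = A∙ (Gen-least A S⊆A g) (Gen-least A S⊆A h)
  Gen-least A@(_ , _ , _ , A⁻¹)      S⊆A (inv g)     = A⁻¹ (Gen-least A S⊆A g)
  Gen-least A@(Aresp , _)            S⊆A (resp e g)  = Aresp e (Gen-least A S⊆A g)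

  Gen-closed : ∀ {S} → SubgroupClosed (Gen G S)
  Gen-closed = resp , unit , mul , inv

  Gen-mono : ∀ {S T} → (∀ {s} → s ∈ S → Gen G T s) → ∀ {x} → Gen G S x → Gen G T x
  Gen-mono = Gen-least Gen-closed

  centraliser-closed : ∀ z → SubgroupClosed (λ a → a ∙ z ≈ z ∙ a)
  centraliser-closed z = respects , commutes-ε , commutes-∙ , commutes-⁻¹
    where
    open import Relation.Binary.Reasoning.Setoid setoid

    respects : ∀ {a b} → a ≈ b → a ∙ z ≈ z ∙ a → b ∙ z ≈ z ∙ b
    respects a≈b az≈za = trans (∙-congʳ (sym a≈b)) (trans az≈za (∙-congˡ a≈b))

    commutes-ε : ε ∙ z ≈ z ∙ ε
    commutes-ε = trans (identityˡ z) (sym (identityʳ z))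

    commutes-∙ : ∀ {a b} → a ∙ z ≈ z ∙ a → b ∙ z ≈ z ∙ b → a ∙ b ∙ z ≈ z ∙ (a ∙ b)
    commutes-∙ {a} {b} az≈za bz≈zb = begin
      a ∙ b ∙ z    ≈⟨ assoc _ _ _ ⟩
      a ∙ (b ∙ z)  ≈⟨ ∙-congˡ bz≈zb ⟩
      a ∙ (z ∙ b)  ≈⟨ assoc _ _ _ ⟨
      a ∙ z ∙ b    ≈⟨ ∙-congʳ az≈za ⟩
      z ∙ a ∙ b    ≈⟨ assoc _ _ _ ⟩
      z ∙ (a ∙ b)  ∎

    commutes-⁻¹ : ∀ {a} → a ∙ z ≈ z ∙ a → a ⁻¹ ∙ z ≈ z ∙ a ⁻¹
    commutes-⁻¹ {a} az≈za = begin
      a ⁻¹ ∙ z                ≈⟨ ∙-congˡ (//-rightDividesʳ a z) ⟨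
      a ⁻¹ ∙ (z ∙ a ∙ a ⁻¹)   ≈⟨ ∙-congˡ (∙-congʳ az≈za) ⟨
      a ⁻¹ ∙ (a ∙ z ∙ a ⁻¹)   ≈⟨ ∙-congˡ (assoc _ _ _) ⟩
      a ⁻¹ ∙ (a ∙ (z ∙ a ⁻¹)) ≈⟨ \\-leftDividesʳ a _ ⟩
      z ∙ a ⁻¹                ∎

  -- In a minimal generating set no entry lies in the subgroup generated by
  -- the others (else dropping it would give a shorter generating list).
  minimal-irredundant : ∀ {S x} → MinGenSet G S → (p : x ∈ S) → ¬ Gen G (S ─ p) x
  minimal-irredundant {S} (genS , minS) p x∈⟨K⟩ =
    <-irrefl refl (subst (_≤ length (S ─ p)) (length-─ p) (minS (S ─ p) genK))
    where
    S⊆⟨K⟩ : ∀ {s} → s ∈ S → Gen G (S ─ p) s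
    S⊆⟨K⟩ s∈S with ∈-─ p s∈S
    ... | inj₁ refl = x∈⟨K⟩
    ... | inj₂ s∈K  = gen s∈K

    genK : Generates G (S ─ p)
    genK y = Gen-mono S⊆⟨K⟩ (genS y)

  -- Exchange lemma: replacing x ∈ S by xg with g ∈ ⟨S ∖ x⟩ keeps a minimal
  -- generating set minimal, because x = (xg)g⁻¹.
  exchange : ∀ {S x g} → MinGenSet G S → (p : x ∈ S) → Gen G (S ─ p) g →
             MinGenSet G (x ∙ g ∷ (S ─ p))
  exchange {S} {x} {g} (genS , minS) p g∈⟨K⟩ =
    (λ y → Gen-mono S⊆⟨S'⟩ (genS y)) ,
    (λ T genT → subst (_≤ length T) (length-─ p) (minS T genT))
    where
    S⊆⟨S'⟩ : ∀ {s} → s ∈ S → Gen G (x ∙ g ∷ (S ─ p)) s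
    S⊆⟨S'⟩ s∈S with ∈-─ p s∈S
    ... | inj₁ refl = resp (//-rightDividesʳ g x)
                        (mul (gen (here refl)) (inv (Gen-mono (λ z∈K → gen (there z∈K)) g∈⟨K⟩)))
    ... | inj₂ s∈K  = gen (there s∈K)

-- Writing x ~ y for
-- x⁻¹y ∈ A (x and y lie in the same left coset), any three elements
-- contain two in the same coset; hence membership in A is decidable and
-- any two elements outside A lie in the same coset.
module IndexTwo {c ℓ : Level} (G : Group c ℓ) {A : Pred (Group.Carrier G) (c ⊔ ℓ)}
                (A-subgroup : IsSubgroup G A) (A-index2 : HasIndex2 G A) where
  open Group G
  open GroupFacts G using (\\-trans; ε\\x≈x)
  open import Algebra.Properties.Group G using (⁻¹-anti-homo-\\)

  private
    A-resp : ∀ {x y} → x ≈ y → A x → A y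
    A-resp = proj₁ A-subgroup

    A-∙ : ∀ {x y} → A x → A y → A (x ∙ y)
    A-∙ = proj₁ (proj₂ (proj₂ A-subgroup))

    A-⁻¹ : ∀ {x} → A x → A (x ⁻¹)
    A-⁻¹ = proj₂ (proj₂ (proj₂ A-subgroup))

    a b : Carrier
    a = proj₁ A-index2
    b = proj₁ (proj₂ A-index2)

  _~_ : Carrier → Carrier → Set (c ⊔ ℓ)
  x ~ y = A (x \\ y)

  private
    a≁b : ¬ a ~ b
    a≁b = proj₁ (proj₂ (proj₂ A-index2))

    cosets : ∀ x → a ~ x ⊎ b ~ x
    cosets = proj₂ (proj₂ (proj₂ A-index2))

  ~-sym : ∀ {x y} → x ~ y → y ~ x
  ~-sym {x} {y} x~y = A-resp (⁻¹-anti-homo-\\ x y) (A-⁻¹ x~y)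

  ~-trans : ∀ {x y z} → x ~ y → y ~ z → x ~ z
  ~-trans {x} {y} {z} x~y y~z = A-resp (\\-trans x y z) (A-∙ x~y y~z)

  same-coset : ∀ {w x y} → w ~ x → w ~ y → x ~ y
  same-coset w~x w~y = ~-trans (~-sym w~x) w~y

  pigeonhole : ∀ x y z → x ~ y ⊎ x ~ z ⊎ y ~ z
  pigeonhole x y z with cosets x | cosets y | cosets z
  ... | inj₁ p | inj₁ q | _      = inj₁ (same-coset p q)
  ... | inj₂ p | inj₂ q | _      = inj₁ (same-coset p q)
  ... | inj₁ p | inj₂ _ | inj₁ r = inj₂ (inj₁ (same-coset p r))
  ... | inj₂ p | inj₁ _ | inj₂ r = inj₂ (inj₁ (same-coset p r))
  ... | inj₁ _ | inj₂ q | inj₂ r = inj₂ (inj₂ (same-coset q r))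
  ... | inj₂ _ | inj₁ q | inj₁ r = inj₂ (inj₂ (same-coset q r))

  -- x ~ y holds iff x and y lie in the same one of aA, bA.
  ~-dec : ∀ x y → Dec (x ~ y)
  ~-dec x y with cosets x | cosets y
  ... | inj₁ a~x | inj₁ a~y = yes (same-coset a~x a~y)
  ... | inj₂ b~x | inj₂ b~y = yes (same-coset b~x b~y)
  ... | inj₁ a~x | inj₂ b~y = no (λ x~y → a≁b (~-trans (~-trans a~x x~y) (~-sym b~y)))
  ... | inj₂ b~x | inj₁ a~y = no (λ x~y → a≁b (~-trans a~y (~-sym (~-trans b~x x~y))))

  member? : ∀ y → Dec (A y)
  member? y = map′ (A-resp (ε\\x≈x y)) (A-resp (sym (ε\\x≈x y))) (~-dec ε y)

  -- Neither s nor t shares the coset of ε, so they share the other one.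
  outside-same-coset : ∀ {s t} → ¬ A s → ¬ A t → t ~ s
  outside-same-coset {s} {t} s∉A t∉A with pigeonhole ε t s
  ... | inj₁ ε~t        = contradiction (A-resp (ε\\x≈x t) ε~t) t∉A
  ... | inj₂ (inj₁ ε~s) = contradiction (A-resp (ε\\x≈x s) ε~s) s∉A
  ... | inj₂ (inj₂ t~s) = t~s

-- (⇐) In a generalized dihedral group every generating list contains an
-- involution.
module DihedralGenerators {c ℓ : Level} (G : Group c ℓ) where
  open Group G
  open GroupFacts G
  open Generation G
  open import Algebra.Properties.Group G using (\\-leftDividesˡ)

  generators-contain-involution :
    IsGeneralizedDihedral G → ∀ S → Generates G S → Any (Involution G) S
  generators-contain-involution
    (A , A-subgroup@(A-resp , A-ε , _) , _ , A-index2 , τ , τ∉A , _ , τ-inverts) S genS =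
    Any.map outside-involution (¬All⇒Any¬ member? S S⊈A)
    where
    open IndexTwo G A-subgroup A-index2

    -- τ ∉ ⟨S⟩ would follow if S ⊆ A.
    S⊈A : ¬ All A S
    S⊈A S⊆A = τ∉A (Gen-least A-subgroup (All.lookup S⊆A) (genS τ))

    -- s ∉ A is s = τa with a = τ⁻¹s ∈ A, and (τa)² = 1 since τ inverts a.
    outside-involution : ∀ {s} → ¬ A s → Involution G s
    outside-involution {s} s∉A =
      (λ s≈ε → s∉A (A-resp (sym s≈ε) A-ε)) ,
      trans (∙-cong (sym (\\-leftDividesˡ τ s)) (sym (\\-leftDividesˡ τ s)))
            (inverted⇒square-ε τ (τ \\ s) (τ-inverts (outside-same-coset s∉A τ∉A)))

-- (⇒, the structural step) The generalized dihedral structure read off a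
-- minimal generating set S with an involution x ∈ S that inverts every z
-- and zw for z, w in K = S ∖ x; then A = ⟨K⟩ and τ = x.
module DihedralCriterion {c ℓ : Level} (G : Group c ℓ) where
  open Group G hiding (refl)
  open GroupFacts G
  open Generation G
  open ListRemoval
  open import Algebra.Properties.Group G using (ε⁻¹≈ε; ⁻¹-anti-homo-∙)

  coset-union-closed : ∀ {p} {A : Pred Carrier p} {x} → SubgroupClosed A → x ∙ x ≈ ε →
                       (∀ {a} → A a → A (conj x a)) → SubgroupClosed (λ y → A y ⊎ A (x \\ y))
  coset-union-closed {p} {A} {x} (A-resp , A-ε , A-∙ , A-⁻¹) xx normal =
    respects , inj₁ A-ε , closed-∙ , closed-⁻¹
    where
    A∪xA : Pred Carrier p
    A∪xA y = A y ⊎ A (x \\ y)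

    respects : ∀ {u v} → u ≈ v → A∪xA u → A∪xA v
    respects u≈v (inj₁ u∈A)  = inj₁ (A-resp u≈v u∈A)
    respects u≈v (inj₂ xu∈A) = inj₂ (A-resp (∙-congˡ u≈v) xu∈A)

    closed-∙ : ∀ {u v} → A∪xA u → A∪xA v → A∪xA (u ∙ v)
    closed-∙ (inj₁ u∈A)  (inj₁ v∈A)  = inj₁ (A-∙ u∈A v∈A)
    closed-∙ (inj₁ u∈A)  (inj₂ xv∈A) = inj₂ (A-resp (sym (\\-∙ˡ xx _ _)) (A-∙ (normal u∈A) xv∈A))
    closed-∙ (inj₂ xu∈A) (inj₁ v∈A)  = inj₂ (A-resp (assoc _ _ _) (A-∙ xu∈A v∈A))
    closed-∙ (inj₂ xu∈A) (inj₂ xv∈A) = inj₁ (A-resp (sym (\\-∙-\\ x _ _)) (A-∙ (normal xu∈A) xv∈A))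

    closed-⁻¹ : ∀ {u} → A∪xA u → A∪xA (u ⁻¹)
    closed-⁻¹ (inj₁ u∈A)  = inj₁ (A-⁻¹ u∈A)
    closed-⁻¹ (inj₂ xu∈A) = inj₂ (A-resp (sym (\\-⁻¹ xx _)) (normal (A-⁻¹ xu∈A)))

  module _ {S x} (minS : MinGenSet G S) (p : x ∈ S) (xx : x ∙ x ≈ ε)
           (inverts : ∀ {z} → z ∈ (S ─ p) → conj x z ≈ z ⁻¹)
           (inverts-∙ : ∀ {z w} → z ∈ (S ─ p) → w ∈ (S ─ p) → conj x (z ∙ w) ≈ (z ∙ w) ⁻¹)
           where

    A : Pred Carrier (c ⊔ ℓ)
    A = Gen G (S ─ p)

    -- Generators z, w commute since x inverts z, w and zw; so A is abelian.
    A-abelian : IsAbelianSubset G A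
    A-abelian {a} {b} a∈A b∈A =
      Gen-least (centraliser-closed b)
        (λ z∈K → sym (Gen-least (centraliser-closed _)
          (λ w∈K → inverted⇒commute xx (inverts w∈K) (inverts z∈K) (inverts-∙ w∈K z∈K)) b∈A))
        a∈A

    -- In the abelian group A the elements inverted by x form a subgroup
    -- containing K, so x inverts all of A.
    A-inverted : ∀ {a} → A a → conj x a ≈ a ⁻¹
    A-inverted a∈A = proj₂ (Gen-least inverted-closed (λ z∈K → gen z∈K , inverts z∈K) a∈A)
      where
      Inverted : Pred Carrier (c ⊔ ℓ)
      Inverted a = A a × conj x a ≈ a ⁻¹

      inverted-closed : SubgroupClosed Inverted
      inverted-closed = respects , (unit , trans (conj-ε xx) (sym ε⁻¹≈ε)) , closed-∙ , closed-⁻¹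
        where
        respects : ∀ {u v} → u ≈ v → Inverted u → Inverted v
        respects u≈v (u∈A , iu) =
          resp u≈v u∈A , trans (conj-cong x (sym u≈v)) (trans iu (⁻¹-cong u≈v))

        closed-∙ : ∀ {u v} → Inverted u → Inverted v → Inverted (u ∙ v)
        closed-∙ {u} {v} (u∈A , iu) (v∈A , iv) = mul u∈A v∈A , (begin
          conj x (u ∙ v)         ≈⟨ conj-∙ xx u v ⟩
          conj x u ∙ conj x v    ≈⟨ ∙-cong iu iv ⟩
          u ⁻¹ ∙ v ⁻¹            ≈⟨ ⁻¹-anti-homo-∙ v u ⟨
          (v ∙ u) ⁻¹             ≈⟨ ⁻¹-cong (A-abelian v∈A u∈A) ⟩
          (u ∙ v) ⁻¹             ∎)
          where open import Relation.Binary.Reasoning.Setoid setoid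

        closed-⁻¹ : ∀ {u} → Inverted u → Inverted (u ⁻¹)
        closed-⁻¹ {u} (u∈A , iu) = inv u∈A , trans (conj-⁻¹ xx u) (⁻¹-cong iu)

    -- x ∉ A by minimality of S, and G = A ∪ xA since S ⊆ A ∪ xA.
    x∉A : ¬ A x
    x∉A = minimal-irredundant minS p

    A-index2 : HasIndex2 G A
    A-index2 = ε , x , (λ ε~x → x∉A (resp (ε\\x≈x x) ε~x)) , covers
      where
      S⊆A∪xA : ∀ {s} → s ∈ S → A s ⊎ A (x \\ s)
      S⊆A∪xA s∈S with ∈-─ p s∈S
      ... | inj₁ ≡.refl = inj₂ (resp (sym (inverseˡ x)) unit)
      ... | inj₂ s∈K    = inj₁ (gen s∈K)

      -- x normalises A, since xax = a⁻¹ ∈ A.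
      x-normalises : ∀ {a} → A a → A (conj x a)
      x-normalises a∈A = resp (sym (A-inverted a∈A)) (inv a∈A)

      covers : ∀ y → A (ε \\ y) ⊎ A (x \\ y)
      covers y with Gen-least (coset-union-closed Gen-closed xx x-normalises) S⊆A∪xA (proj₁ minS y)
      ... | inj₁ y∈A  = inj₁ (resp (sym (ε\\x≈x y)) y∈A)
      ... | inj₂ xy∈A = inj₂ xy∈A

    dihedral : IsGeneralizedDihedral G
    dihedral = A , Gen-closed , A-abelian , A-index2 , x , x∉A , xx , A-inverted

module LeastNumber {p} {P : Pred ℕ p} (P? : Decidable P) where

  Least : Set p
  Least = Σ ℕ λ m → P m × (∀ k → k < m → ¬ P k)

  search : ∀ n → Least ⊎ (∀ k → k < n → ¬ P k)
  search zero = inj₂ (λ _ ())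
  search (suc n) with search n
  ... | inj₁ least = inj₁ least
  ... | inj₂ none with P? n
  ...   | yes Pn = inj₁ (n , Pn , none)
  ...   | no ¬Pn = inj₂ below
    where
    below : ∀ k → k < suc n → ¬ P k
    below k k<1+n with m<1+n⇒m<n∨m≡n k<1+n
    ... | inj₁ k<n  = none k k<n
    ... | inj₂ refl = ¬Pn

  least : ∀ {n} → P n → Least
  least {n} Pn with search (suc n)
  ... | inj₁ found = found
  ... | inj₂ none  = contradiction Pn (none n ≤-refl)

module FiniteSearch {n : ℕ} where

  ⟦_⟧ : ∀ {p} {P : Pred (Fin n) p} → Decidable P → Subset n
  ⟦ P? ⟧ = tabulate (λ i → does (P? i))

  ∈⟦⟧⁺ : ∀ {p} {P : Pred (Fin n) p} (P? : Decidable P) {i} → P i → i ∈ₛ ⟦ P? ⟧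
  ∈⟦⟧⁺ P? {i} Pi = lookup⇒[]= i _ (≡.trans (lookup∘tabulate _ i) (dec-true (P? i) Pi))

  ∈⟦⟧⁻ : ∀ {p} {P : Pred (Fin n) p} (P? : Decidable P) {i} → i ∈ₛ ⟦ P? ⟧ → P i
  ∈⟦⟧⁻ P? {i} i∈P = witness (P? i) (≡.trans (≡.sym (lookup∘tabulate _ i)) ([]=⇒lookup i∈P))
    where
    witness : ∀ {q} {Q : Set q} (Q? : Dec Q) → does Q? ≡ true → Q
    witness (yes q) _ = q

  -- Iterating an inflationary operator on subsets from C, while it still
  -- grows, reaches a set D ⊇ C closed under the operator (⊂ is well
  -- founded on the finite lattice); an invariant of the operator is kept.
  saturate : ∀ {p} (f : Subset n → Subset n) → (∀ C → C ⊆ f C) →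
             (Inv : Subset n → Set p) → (∀ {C} → Inv C → Inv (f C)) →
             ∀ C → Inv C → Σ (Subset n) λ D → C ⊆ D × Inv D × f D ⊆ D
  saturate f inflationary Inv preserved C InvC = go C InvC (⊃-wellFounded C)
    where
    go : ∀ C → Inv C → Acc _⊃_ C → Σ (Subset n) λ D → C ⊆ D × Inv D × f D ⊆ D
    go C InvC (acc smaller) with C ⊂? f C
    ... | yes C⊂fC with go (f C) (preserved InvC) (smaller C⊂fC)
    ...   | D , fC⊆D , InvD , closed = D , (λ i∈C → fC⊆D (inflationary C i∈C)) , InvD , closed
    go C InvC _ | no C⊄fC = C , (λ i∈C → i∈C) , InvC , fC⊆C
      where
      fC⊆C : f C ⊆ C
      fC⊆C {i} i∈fC with i ∈? C
      ... | yes i∈C = i∈C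
      ... | no  i∉C = contradiction ((λ {j} → inflationary C {j}) , i , i∈fC , i∉C) C⊄fC

  any-list? : ∀ {p} {P : Pred (List (Fin n)) p} → Decidable P → ∀ k →
              Dec (Σ (List (Fin n)) λ is → length is ≡ k × P is)
  any-list? P? zero with P? []
  ... | yes P[] = yes ([] , refl , P[])
  ... | no ¬P[] = no λ { ([] , _ , P[]) → ¬P[] P[] ; (_ ∷ _ , () , _) }
  any-list? P? (suc k) with Fin.any? (λ i → any-list? (λ is → P? (i ∷ is)) k)
  ... | yes (i , is , len , Pis) = yes (i ∷ is , cong suc len , Pis)
  ... | no none = no λ { ([] , () , _) ; (i ∷ is , len , Pis) → none (i , is , suc-injective len , Pis) }

module FiniteGroup {c ℓ : Level} (G : Group c ℓ) (n : ℕ)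
                   (I : Inverse (Group.setoid G) (≡.setoid (Fin n))) where
  open Group G hiding (refl)
  open Generation G
  open FiniteSearch {n}
  open Inverse I using (to; from; to-cong) renaming (strictlyInverseʳ to from-to)
  open import Algebra.Properties.Group G using (//-rightDividesˡ; //-rightDividesʳ; ε⁻¹≈ε; ⁻¹-anti-homo-∙; ⁻¹-involutive)

  infix 4 _≈?_
  _≈?_ : ∀ x y → Dec (x ≈ y)
  x ≈? y = map′ to-injective to-cong (to x Fin.≟ to y)
    where
    to-injective : to x ≡ to y → x ≈ y
    to-injective eq = trans (sym (from-to x)) (trans (reflexive (cong from eq)) (from-to y))

  Involution? : Decidable (Involution G)
  Involution? x = ¬? (x ≈? ε) ×-dec (x ∙ x ≈? ε)

  -- The subgroup ⟨T⟩, computed as the saturation of {ε} under right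
  -- multiplication by the elements of T and their inverses.
  module Span (T : List Carrier) where

    T± : List Carrier
    T± = T ++ map _⁻¹ T

    T±⊆⟨T⟩ : ∀ {u} → u ∈ T± → Gen G T u
    T±⊆⟨T⟩ u∈T± with ∈-++⁻ T u∈T±
    ... | inj₁ u∈T = gen u∈T
    ... | inj₂ u∈T⁻¹ with ∈-map⁻ _⁻¹ u∈T⁻¹
    ...   | t , t∈T , refl = inv (gen t∈T)

    -- One step: C ∪ C·T±.
    Step : Subset n → Pred (Fin n) c
    Step C i = i ∈ₛ C ⊎ Any (λ u → to (from i ∙ u ⁻¹) ∈ₛ C) T±

    step? : ∀ C → Decidable (Step C)
    step? C i = (i ∈? C) ⊎-dec any? (λ u → to (from i ∙ u ⁻¹) ∈? C) T±

    step : Subset n → Subset n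
    step C = ⟦ step? C ⟧

    InSpan : Subset n → Set (c ⊔ ℓ)
    InSpan C = ∀ {i} → i ∈ₛ C → Gen G T (from i)

    step-preserves : ∀ {C} → InSpan C → InSpan (step C)
    step-preserves {C} C⊆⟨T⟩ {i} i∈step with ∈⟦⟧⁻ (step? C) i∈step
    ... | inj₁ i∈C = C⊆⟨T⟩ i∈C
    ... | inj₂ iu⁻¹∈C with find iu⁻¹∈C
    ...   | u , u∈T± , iu⁻¹∈C' =
      resp (//-rightDividesˡ u (from i)) (mul (resp (from-to _) (C⊆⟨T⟩ iu⁻¹∈C')) (T±⊆⟨T⟩ u∈T±))

    ε-InSpan : InSpan ⁅ to ε ⁆
    ε-InSpan i∈ε = subst (λ j → Gen G T (from j)) (≡.sym (x∈⁅y⁆⇒x≡y (to ε) i∈ε))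
                         (resp (sym (from-to ε)) unit)

    span : Σ (Subset n) λ D → ⁅ to ε ⁆ ⊆ D × InSpan D × step D ⊆ D
    span = saturate step (λ C i∈C → ∈⟦⟧⁺ (step? C) (inj₁ i∈C)) InSpan step-preserves ⁅ to ε ⁆ ε-InSpan

    D : Subset n
    D = proj₁ span

    D-in-span : InSpan D
    D-in-span = proj₁ (proj₂ (proj₂ span))

    D-closed : step D ⊆ D
    D-closed = proj₂ (proj₂ (proj₂ span))

    _∈D : Carrier → Set
    y ∈D = to y ∈ₛ D

    ε∈D : ε ∈D
    ε∈D = proj₁ (proj₂ span) (x∈⁅x⁆ (to ε))

    ∈D-resp : ∀ {x y} → x ≈ y → x ∈D → y ∈D
    ∈D-resp x≈y = subst (_∈ₛ D) (to-cong x≈y)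

    Stabilises : Carrier → Set c
    Stabilises x = (∀ {y} → y ∈D → (y ∙ x) ∈D) × (∀ {y} → y ∈D → (y ∙ x ⁻¹) ∈D)

    T±-stabilises : ∀ {u} → u ∈ T± → ∀ {y} → y ∈D → (y ∙ u) ∈D
    T±-stabilises {u} u∈T± {y} y∈D = D-closed (∈⟦⟧⁺ (step? D) (inj₂ (lose u∈T± y∈D')))
      where
      y∈D' : (from (to (y ∙ u)) ∙ u ⁻¹) ∈D
      y∈D' = ∈D-resp (sym (trans (∙-congʳ (from-to (y ∙ u))) (//-rightDividesʳ u y))) y∈D

    -- The stabilisers form a subgroup containing T, hence all of ⟨T⟩.
    stabilises-closed : SubgroupClosed Stabilises
    stabilises-closed = respects , (by-ε , by-ε⁻¹) , closed-∙ , closed-⁻¹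
      where
      respects : ∀ {x x'} → x ≈ x' → Stabilises x → Stabilises x'
      respects x≈x' (right , left) =
        (λ y∈D → ∈D-resp (∙-congˡ x≈x') (right y∈D)) ,
        (λ y∈D → ∈D-resp (∙-congˡ (⁻¹-cong x≈x')) (left y∈D))

      by-ε : ∀ {y} → y ∈D → (y ∙ ε) ∈D
      by-ε = ∈D-resp (sym (identityʳ _))

      by-ε⁻¹ : ∀ {y} → y ∈D → (y ∙ ε ⁻¹) ∈D
      by-ε⁻¹ = ∈D-resp (sym (trans (∙-congˡ ε⁻¹≈ε) (identityʳ _)))

      closed-∙ : ∀ {x x'} → Stabilises x → Stabilises x' → Stabilises (x ∙ x')
      closed-∙ {x} {x'} (right , left) (right' , left') =
        (λ y∈D → ∈D-resp (assoc _ _ _) (right' (right y∈D))) ,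
        (λ y∈D → ∈D-resp (trans (assoc _ _ _) (∙-congˡ (sym (⁻¹-anti-homo-∙ x x')))) (left (left' y∈D)))

      closed-⁻¹ : ∀ {x} → Stabilises x → Stabilises (x ⁻¹)
      closed-⁻¹ (right , left) = left , (λ y∈D → ∈D-resp (∙-congˡ (sym (⁻¹-involutive _))) (right y∈D))

    ⟨T⟩⊆D : ∀ {x} → Gen G T x → x ∈D
    ⟨T⟩⊆D {x} x∈⟨T⟩ = ∈D-resp (identityˡ x) (proj₁ (Gen-least stabilises-closed T-stabilises x∈⟨T⟩) ε∈D)
      where
      T-stabilises : ∀ {t} → t ∈ T → Stabilises t
      T-stabilises t∈T = T±-stabilises (∈-++⁺ˡ t∈T) , T±-stabilises (∈-++⁺ʳ T (∈-map⁺ _⁻¹ t∈T))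

    Gen? : ∀ x → Dec (Gen G T x)
    Gen? x = map′ (λ x∈D → resp (from-to x) (D-in-span x∈D)) ⟨T⟩⊆D (to x ∈? D)

  Generates? : ∀ T → Dec (Generates G T)
  Generates? T = map′ (λ all x → resp (from-to x) (all (to x))) (λ gen-all i → gen-all (from i))
                      (Fin.all? (λ i → Span.Gen? T (from i)))

  all-codes-generate : Σ (List (Fin n)) λ is → length is ≡ n × Generates G (map from is)
  all-codes-generate =
    allFin n , length-tabulate (λ i → i) , (λ x → resp (from-to x) (gen (∈-map⁺ from (∈-allFin (to x)))))

  -- A minimal generating set: the shortest list of codes whose image
  -- generates; a generating list T is no shorter, as its codes generate too.
  minimal-generating-set : Σ (List Carrier) (MinGenSet G)
  minimal-generating-set
    with LeastNumber.least (any-list? (λ is → Generates? (map from is))) all-codes-generate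
  ... | _ , (is , len , gen-is) , shortest = map from is , gen-is , no-shorter
    where
    codes-generate : ∀ T → Generates G T → Generates G (map from (map to T))
    codes-generate T genT y =
      Gen-mono (λ t∈T → resp (from-to _) (gen (∈-map⁺ from (∈-map⁺ to t∈T)))) (genT y)

    no-shorter : ∀ T → Generates G T → length (map from is) ≤ length T
    no-shorter T genT = subst (_≤ length T) (≡.sym (≡.trans (length-map from is) len))
      (≮⇒≥ (λ T<is → shortest (length T) T<is (map to T , length-map to T , codes-generate T genT)))

module Descent {c ℓ : Level} (G : Group c ℓ) (n : ℕ)
               (I : Inverse (Group.setoid G) (≡.setoid (Fin n)))
               (hypothesis : ∀ S → MinGenSet G S → Any (Involution G) S) where
  open Group G hiding (refl)
  open GroupFacts G using (square-ε⇒inverted)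
  open Generation G
  open ListRemoval
  open DihedralCriterion G using (dihedral)
  open FiniteGroup G n I using (Involution?; minimal-generating-set)

  involutions : List Carrier → ℕ
  involutions S = length (filter Involution? S)

  fewer : ∀ {S x y} (p : x ∈ S) → Involution G x → ¬ Involution G y →
          involutions (y ∷ (S ─ p)) < involutions S
  fewer {S} {y = y} p x-inv y-not = begin-strict
    involutions (y ∷ (S ─ p))  ≡⟨ cong length (filter-reject Involution? y-not) ⟩
    involutions (S ─ p)        <⟨ n<1+n (involutions (S ─ p)) ⟩
    suc (involutions (S ─ p))  ≡⟨ count-─ Involution? p x-inv ⟨
    involutions S              ∎
    where open ≤-Reasoning

  inverts-or-witness : ∀ x K →
    ((∀ {z} → z ∈ K → Involution G (x ∙ z)) ×
     (∀ {z w} → z ∈ K → w ∈ K → Involution G (x ∙ (z ∙ w))))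
    ⊎ Σ Carrier λ g → Gen G K g × ¬ Involution G (x ∙ g)
  inverts-or-witness x K
    with all? (λ z → Involution? (x ∙ z)) K
       | all? (λ z → all? (λ w → Involution? (x ∙ (z ∙ w))) K) K
  ... | yes all-z | yes all-zw =
    inj₁ (All.lookup all-z , λ z∈K w∈K → All.lookup (All.lookup all-zw z∈K) w∈K)
  ... | no some-z | _ with find (¬All⇒Any¬ (λ z → Involution? (x ∙ z)) K some-z)
  ...   | z , z∈K , xz-not = inj₂ (z , gen z∈K , xz-not)
  inverts-or-witness x K | yes _ | no some-zw
    with find (¬All⇒Any¬ (λ z → all? (λ w → Involution? (x ∙ (z ∙ w))) K) K some-zw)
  ... | z , z∈K , some-w with find (¬All⇒Any¬ (λ w → Involution? (x ∙ (z ∙ w))) K some-w)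
  ...   | w , w∈K , xzw-not = inj₂ (z ∙ w , mul (gen z∈K) (gen w∈K) , xzw-not)

  descend : ∀ N S → involutions S < N → MinGenSet G S → IsGeneralizedDihedral G
  descend (suc N) S (s≤s bound) minS with find (hypothesis S minS)
  ... | x , p , x-inv with inverts-or-witness x (S ─ p)
  ...   | inj₁ (inverts , inverts-∙) =
    dihedral minS p (proj₂ x-inv)
      (λ z∈K → square-ε⇒inverted x _ (proj₂ (inverts z∈K)))
      (λ z∈K w∈K → square-ε⇒inverted x _ (proj₂ (inverts-∙ z∈K w∈K)))
  ...   | inj₂ (g , g∈⟨K⟩ , xg-not) =
    descend N (x ∙ g ∷ (S ─ p)) (<-≤-trans (fewer p x-inv xg-not) bound) (exchange minS p g∈⟨K⟩)

  generalized-dihedral : IsGeneralizedDihedral G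
  generalized-dihedral =
    descend (suc (involutions S₀)) S₀ ≤-refl (proj₂ minimal-generating-set)
    where
    S₀ : List Carrier
    S₀ = proj₁ minimal-generating-set

lemma2p6 : {c ℓ : Level} (G : Group c ℓ) → IsFiniteGroup G →
    ((∀ (S : List (Group.Carrier G)) → MinGenSet G S → Any (Involution G) S)
      ⇔ IsGeneralizedDihedral G)
lemma2p6 G (n , I) = mk⇔
  (Descent.generalized-dihedral G n I)
  (λ dihedral S minS → DihedralGenerators.generators-contain-involution G dihedral S (proj₁ minS))
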